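{- Let $G$ be a $3$-tessellable diamond-free graph. If $C_1$ and $C_2$ are two maximal cliques of $G$ with a common vertex, then $C_1$ and $C_2$ cannot both be exposed by a minimum tessellation cover of $G$.
   Context: A graph is diamond-free if it has no induced subgraph isomorphic to $K_4$ minus an edge. A tessellation $\mathcal{T}$ of $G$ is a partition of $V(G)$ into cliques; an edge belongs to $\mathcal{T}$ iff its endpoints lie in the same clique of $\mathcal{T}$, and $\mathcal{E}(\mathcal{T})$ is the set of such edges. A tessellation cover is a set of tessellations whose edge sets cover $E(G)$; $T(G)$ is the minimum size of a tessellation cover, and a minimum tessellation cover is one of size $T(G)$. $G$ is $t$-tessellable if it has a tessellation cover of size at most $t$. A maximal clique $K$ is exposed by a tessellation cover $\mathcal{C}$ if $E(K)\not\subseteq\mathcal{E}(\mathcal{T})$ for all $\mathcal{T}\in\mathcal{C}$. -}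

module Defs where

open import Data.Nat using (ℕ; _≤_)
open import Data.Fin using (Fin)
open import Data.Bool using (Bool; true; false)
open import Data.Product using (Σ; ∃; _×_; _,_)
open import Relation.Binary.PropositionalEquality using (_≡_; _≢_)
open import Relation.Nullary using (¬_)

record Graph (n : ℕ) : Set where
  field
    edge    : Fin n → Fin n → Bool
    sym     : ∀ u v → edge u v ≡ edge v u
    irrefl  : ∀ v → edge v v ≡ false

module _ {n : ℕ} (G : Graph n) where
  open Graph G

  Adj : Fin n → Fin n → Set
  Adj u v = edge u v ≡ true

  VSet : Set
  VSet = Fin n → Bool

  _∈_ : Fin n → VSet → Set
  v ∈ S = S v ≡ true

  IsClique : VSet → Set
  IsClique K = ∀ u v → u ∈ K → v ∈ K → u ≢ v → Adj u v

  IsMaximalClique : VSet → Set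
  IsMaximalClique K =
    IsClique K × (∀ w → ¬ (w ∈ K) → ¬ (∀ u → u ∈ K → Adj w u))

  -- no induced diamond (K4 minus the edge ad)
  DiamondFree : Set
  DiamondFree = ∀ a b c d → a ≢ d →
    Adj a b → Adj a c → Adj b c → Adj b d → Adj c d → Adj a d

  -- A tessellation: a partition of V(G) into cliques, given by a labelling of
  -- each vertex with the (index of the) part containing it; every part is a clique.
  record Tessellation : Set where
    field
      part     : Fin n → Fin n
      isClique : ∀ u v → part u ≡ part v → u ≢ v → Adj u v

  open Tessellation

  InTess : Tessellation → Fin n → Fin n → Set
  InTess T u v = Adj u v × (part T u ≡ part T v)

  IsTessCover : (k : ℕ) → (Fin k → Tessellation) → Set
  IsTessCover k C = ∀ u v → Adj u v → ∃ λ i → InTess (C i) u v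

  Tessellable : ℕ → Set
  Tessellable t = Σ ℕ λ k → k ≤ t × Σ (Fin k → Tessellation) λ C → IsTessCover k C

  IsMinTessCover : (k : ℕ) → (Fin k → Tessellation) → Set
  IsMinTessCover k C = IsTessCover k C ×
    (∀ k′ (C′ : Fin k′ → Tessellation) → IsTessCover k′ C′ → k ≤ k′)

  Exposed : (k : ℕ) → (Fin k → Tessellation) → VSet → Set
  Exposed k C K = ∀ i → ¬ (∀ u v → u ∈ K → v ∈ K → Adj u v → InTess (C i) u v)

module Submission where

-- Let v be a common vertex of the distinct maximal cliques C₁, C₂ of a
-- diamond-free graph, and let C be a minimum tessellation cover.  Say that a
-- clique K "meets v in tessellation i" if some other vertex of K lies in the
-- same part of tessellation i as v.  The proof combines three facts:
--   * C₁ and C₂ each contain a vertex other than v, since maximal cliques are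
--     incomparable under inclusion;
--   * an exposed clique with two vertices meets v in at least two different
--     tessellations (otherwise one tessellation would contain all its edges);
--   * in a diamond-free graph, C₁ and C₂ never meet v in the same tessellation,
--     because a maximal clique absorbs every common neighbour of two of its
--     vertices, and two distinct maximal cliques share at most one vertex.
-- Hence exposing both cliques needs four pairwise distinct tessellations,
-- whereas minimality and 3-tessellability bound the cover size by 3.

open import Defs
open import Data.Nat using (ℕ; _≤_; s≤s)
open import Data.Nat.Properties using (≤-trans)
open import Data.Fin using (Fin; zero; suc; _≟_)
open import Data.Fin.Properties using (any?; injective⇒≤)
open import Data.Bool using (true; false)
import Data.Bool as Bool
open import Data.Product using (∃; _×_; _,_; proj₁)
open import Data.Empty using (⊥-elim)
open import Relation.Binary.PropositionalEquality
  using (_≡_; _≢_; refl; sym; trans)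
open import Relation.Nullary using (¬_; Dec; yes; no; ¬?; _×-dec_)

four-distinct⇒4≤k : ∀ {k} (a b c d : Fin k) →
  a ≢ b → a ≢ c → a ≢ d → b ≢ c → b ≢ d → c ≢ d → 4 ≤ k
four-distinct⇒4≤k {k} a b c d a≢b a≢c a≢d b≢c b≢d c≢d = injective⇒≤ injective
  where
  f : Fin 4 → Fin k
  f zero                   = a
  f (suc zero)             = b
  f (suc (suc zero))       = c
  f (suc (suc (suc zero))) = d

  injective : ∀ {i j} → f i ≡ f j → i ≡ j
  injective {zero}                   {zero}                   _ = refl
  injective {suc zero}               {suc zero}               _ = refl
  injective {suc (suc zero)}         {suc (suc zero)}         _ = refl
  injective {suc (suc (suc zero))}   {suc (suc (suc zero))}   _ = refl
  injective {zero}                   {suc zero}               e = ⊥-elim (a≢b e)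
  injective {zero}                   {suc (suc zero)}         e = ⊥-elim (a≢c e)
  injective {zero}                   {suc (suc (suc zero))}   e = ⊥-elim (a≢d e)
  injective {suc zero}               {suc (suc zero)}         e = ⊥-elim (b≢c e)
  injective {suc zero}               {suc (suc (suc zero))}   e = ⊥-elim (b≢d e)
  injective {suc (suc zero)}         {suc (suc (suc zero))}   e = ⊥-elim (c≢d e)
  injective {suc zero}               {zero}                   e = ⊥-elim (a≢b (sym e))
  injective {suc (suc zero)}         {zero}                   e = ⊥-elim (a≢c (sym e))
  injective {suc (suc (suc zero))}   {zero}                   e = ⊥-elim (a≢d (sym e))
  injective {suc (suc zero)}         {suc zero}               e = ⊥-elim (b≢c (sym e))
  injective {suc (suc (suc zero))}   {suc zero}               e = ⊥-elim (b≢d (sym e))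
  injective {suc (suc (suc zero))}   {suc (suc zero)}         e = ⊥-elim (c≢d (sym e))

module _ {n : ℕ} (G : Graph n) where
  open Tessellation

  _⊆_ : VSet G → VSet G → Set
  P ⊆ Q = ∀ w → _∈_ G w P → _∈_ G w Q

  _∈?_ : ∀ w (P : VSet G) → Dec (_∈_ G w P)
  w ∈? P = P w Bool.≟ true

  adj-sym : ∀ {x y} → Adj G x y → Adj G y x
  adj-sym {x} {y} xy = trans (Graph.sym G y x) xy

  ⊆-antisym : ∀ {P Q} → P ⊆ Q → Q ⊆ P → ∀ w → P w ≡ Q w
  ⊆-antisym {P} {Q} P⊆Q Q⊆P w with P w in Pw | Q w in Qw
  ... | true  | true  = refl
  ... | false | false = refl
  ... | true  | false = trans (sym (P⊆Q w Pw)) Qw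
  ... | false | true  = trans (sym Pw) (Q⊆P w Qw)

  maximal-⊆⇒≡ : ∀ {K L} → IsMaximalClique G K → IsMaximalClique G L →
    K ⊆ L → ∀ w → K w ≡ L w
  maximal-⊆⇒≡ {K} {L} (_ , K-max) (L-clique , _) K⊆L = ⊆-antisym K⊆L L⊆K
    where
    L⊆K : L ⊆ K
    L⊆K w wL with w ∈? K
    ... | yes wK = wK
    ... | no  w∉K = ⊥-elim (K-max w w∉K λ u uK →
            L-clique w u wL (K⊆L u uK) λ { refl → w∉K uK })

  other-vertex : ∀ {K L} → IsMaximalClique G K → IsMaximalClique G L →
    ¬ (∀ w → K w ≡ L w) → ∀ {v} → _∈_ G v K → _∈_ G v L →
    ∃ λ x → _∈_ G x K × x ≢ v
  other-vertex {K} {L} K-max L-max K≢L {v} vK vL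
    with any? (λ x → (x ∈? K) ×-dec ¬? (x ≟ v))
  ... | yes found = found
  ... | no  none  = ⊥-elim (K≢L (maximal-⊆⇒≡ K-max L-max K⊆L))
    where
    K⊆L : K ⊆ L
    K⊆L w wK with w ≟ v
    ... | yes refl = vL
    ... | no  w≢v  = ⊥-elim (none (w , wK , w≢v))

  module DiamondFreeFacts (df : DiamondFree G) where

    absorb : ∀ {K} → IsMaximalClique G K → ∀ {a b y} → _∈_ G a K → _∈_ G b K →
      a ≢ b → Adj G y a → Adj G y b → _∈_ G y K
    absorb {K} (K-clique , K-max) {a} {b} {y} aK bK a≢b ya yb with y ∈? K
    ... | yes yK  = yK
    ... | no  y∉K = ⊥-elim (K-max y y∉K y-adj-K)
      where
      y-adj-K : ∀ u → _∈_ G u K → Adj G y u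
      y-adj-K u uK with u ≟ a | u ≟ b | y ≟ u
      ... | yes refl | _        | _        = ya
      ... | no  _    | yes refl | _        = yb
      ... | no  _    | no  _    | yes refl = ⊥-elim (y∉K uK)
      ... | no  u≢a  | no  u≢b  | no  y≢u  =
        df y a b u y≢u ya yb (K-clique a b aK bK a≢b)
           (K-clique a u aK uK λ e → u≢a (sym e))
           (K-clique b u bK uK λ e → u≢b (sym e))

    share-two⇒equal : ∀ {K L} → IsMaximalClique G K → IsMaximalClique G L →
      ∀ {a b} → _∈_ G a K → _∈_ G b K → _∈_ G a L → _∈_ G b L → a ≢ b →
      ∀ w → K w ≡ L w
    share-two⇒equal {K} {L} K-max L-max {a} {b} aK bK aL bL a≢b =
      maximal-⊆⇒≡ K-max L-max K⊆L
      where
      K⊆L : K ⊆ L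
      K⊆L w wK with w ≟ a | w ≟ b
      ... | yes refl | _        = aL
      ... | no  _    | yes refl = bL
      ... | no  w≢a  | no  w≢b  =
        absorb L-max aL bL a≢b (proj₁ K-max w a wK aK w≢a)
                               (proj₁ K-max w b wK bK w≢b)

  module CoverFacts {k : ℕ} (C : Fin k → Tessellation G)
                    (cover : IsTessCover G k C) where

    Meets : VSet G → Fin n → Fin k → Set
    Meets K v i = ∃ λ x → _∈_ G x K × x ≢ v × part (C i) x ≡ part (C i) v

    meets? : ∀ K v i → Dec (Meets K v i)
    meets? K v i = any? λ x → (x ∈? K) ×-dec ¬? (x ≟ v) ×-dec (part (C i) x ≟ part (C i) v)

    -- If an exposed clique K ∋ v meets v in no tessellation other than i,
    -- then all of K lies in v's part of tessellation i, so E(K) ⊆ E(T_i).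
    exposed⇒meets-elsewhere : ∀ {K} → IsClique G K → Exposed G k C K →
      ∀ {v} → _∈_ G v K → ∀ i → ∃ λ j → j ≢ i × Meets K v j
    exposed⇒meets-elsewhere {K} K-clique exposed {v} vK i
      with any? (λ j → ¬? (j ≟ i) ×-dec meets? K v j)
    ... | yes found   = found
    ... | no  nowhere = ⊥-elim (exposed i λ u w uK wK uw →
                          uw , trans (in-part-of-v u uK) (sym (in-part-of-v w wK)))
      where
      in-part-of-v : ∀ u → _∈_ G u K → part (C i) u ≡ part (C i) v
      in-part-of-v u uK with u ≟ v
      ... | yes refl = refl
      ... | no  u≢v  with cover u v (K-clique u v uK vK u≢v)
      ... | j , _ , same-part with j ≟ i
      ...   | yes refl = same-part
      ...   | no  j≢i  = ⊥-elim (nowhere (j , j≢i , u , uK , u≢v , same-part))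

    -- An exposed clique with a second vertex x ≠ v meets v in two
    -- different tessellations: the one covering the edge xv, and another.
    exposed⇒meets-twice : ∀ {K} → IsClique G K → Exposed G k C K →
      ∀ {v} → _∈_ G v K → (∃ λ x → _∈_ G x K × x ≢ v) →
      ∃ λ i → ∃ λ j → i ≢ j × Meets K v i × Meets K v j
    exposed⇒meets-twice K-clique exposed {v} vK (x , xK , x≢v)
      with cover x v (K-clique x v xK vK x≢v)
    ... | i , _ , same-part with exposed⇒meets-elsewhere K-clique exposed vK i
    ...   | j , j≢i , meets-j =
      i , j , (λ e → j≢i (sym e)) , (x , xK , x≢v , same-part) , meets-j

    -- In a diamond-free graph, distinct maximal cliques through v never meet v
    -- in the same tessellation: the part of v would contain x ∈ K and y ∈ L,
    -- and then K and L would share a second vertex besides v.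
    meets-apart : DiamondFree G → ∀ {K L} →
      IsMaximalClique G K → IsMaximalClique G L → ¬ (∀ w → K w ≡ L w) →
      ∀ {v} → _∈_ G v K → _∈_ G v L → ∀ {i j} → Meets K v i → Meets L v j → i ≢ j
    meets-apart df {K} K-max L-max K≢L {v} vK vL
      {i} (x , xK , x≢v , x∼v) (y , yL , y≢v , y∼v) refl =
      K≢L (share-two⇒equal K-max L-max vK yK vL yL λ e → y≢v (sym e))
      where
      open DiamondFreeFacts df
      yK : _∈_ G y K
      yK with x ≟ y
      ... | yes refl = xK
      ... | no  x≢y  = absorb K-max vK xK (λ e → x≢v (sym e))
                         (isClique (C i) y v y∼v y≢v)
                         (adj-sym (isClique (C i) x y (trans x∼v (sym y∼v)) x≢y))

lemma2 : ∀ {n} (G : Graph n) → DiamondFree G → Tessellable G 3 →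
    (C₁ C₂ : VSet G) → IsMaximalClique G C₁ → IsMaximalClique G C₂ →
    ¬ (∀ v → C₁ v ≡ C₂ v) → (∃ λ v → _∈_ G v C₁ × _∈_ G v C₂) →
    (k : ℕ) (C : Fin k → Tessellation G) → IsMinTessCover G k C →
    ¬ (Exposed G k C C₁ × Exposed G k C C₂)
lemma2 G df (k′ , k′≤3 , C′ , cover′) C₁ C₂ max₁ max₂ C₁≢C₂ (v , v₁ , v₂)
       k C (cover , minimal) (exposed₁ , exposed₂) =
  4≰3 (≤-trans (needs-four twice₁ twice₂) k≤3)
  where
  open CoverFacts G C cover

  k≤3 : k ≤ 3
  k≤3 = ≤-trans (minimal k′ C′ cover′) k′≤3

  twice₁ : ∃ λ i → ∃ λ j → i ≢ j × Meets C₁ v i × Meets C₁ v j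
  twice₁ = exposed⇒meets-twice (proj₁ max₁) exposed₁ v₁
             (other-vertex G max₁ max₂ C₁≢C₂ v₁ v₂)

  twice₂ : ∃ λ i → ∃ λ j → i ≢ j × Meets C₂ v i × Meets C₂ v j
  twice₂ = exposed⇒meets-twice (proj₁ max₂) exposed₂ v₂
             (other-vertex G max₂ max₁ (λ e → C₁≢C₂ λ w → sym (e w)) v₂ v₁)

  apart : ∀ {i j} → Meets C₁ v i → Meets C₂ v j → i ≢ j
  apart = meets-apart df max₁ max₂ C₁≢C₂ v₁ v₂

  needs-four : (∃ λ i → ∃ λ j → i ≢ j × Meets C₁ v i × Meets C₁ v j) →
               (∃ λ i → ∃ λ j → i ≢ j × Meets C₂ v i × Meets C₂ v j) → 4 ≤ k
  needs-four (i₁ , j₁ , i₁≢j₁ , mi₁ , mj₁) (i₂ , j₂ , i₂≢j₂ , mi₂ , mj₂) =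
    four-distinct⇒4≤k i₁ j₁ i₂ j₂ i₁≢j₁ (apart mi₁ mi₂) (apart mi₁ mj₂)
                      (apart mj₁ mi₂) (apart mj₁ mj₂) i₂≢j₂

  4≰3 : ¬ (4 ≤ 3)
  4≰3 (s≤s (s≤s (s≤s ())))
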